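{- Let $T=(P,B)$ be a template of length $t$ such that the binary string $B$ contains exactly $k$ zeros, and let $\sigma$ be a pattern (permutation) of length $l>0$. If there exists $n$ such that $R_{n,T}$ contains a permutation containing $\sigma$ as a pattern, then there exists $m\le (l-1)(k+1)+1$ such that $R_{m,T}$ contains a permutation containing $\sigma$ as a pattern.
   Context: A permutation $\pi$ contains a pattern $\sigma$ if some subsequence of $\pi$ is order-isomorphic to $\sigma$. A template of length $t\ge1$ is a pair $T=(P,B)$ where $P=p_1\cdots p_t$ is a permutation of $\{1,\dots,t\}$ and $B=b_1\cdots b_t$ is a binary string of length $t$. The sets $R_{n,T}$ of permutations of length $n$ are defined recursively: $R_{0,T}$ consists of the empty permutation and $R_{1,T}=\{1\}$; for $n\ge 2$, $R_{n,T}$ is the set of permutations $\pi$ of length $n$ that can be divided into consecutive (possibly empty) subwords $W_1,\dots,W_t$ (so $\pi$ is the concatenation $W_1W_2\cdots W_t$) such that: whenever $p_i>p_j$, every entry of $W_i$ is greater than every entry of $W_j$; each $W_i$ of length $l$, viewed up to order-isomorphism (i.e. standardized to a permutation of $\{1,\dots,l\}$), is an element of $R_{l,T}$; and whenever $b_i=0$, $W_i$ has exactly one element. -}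

module Defs where

open import Data.Nat using (ℕ; zero; suc; _+_; _<_; _>_; _≤_)
open import Data.Bool using (Bool; true; false)
open import Data.Fin as Fin using (Fin)
open import Data.List using (List; []; _∷_; length; lookup; applyUpTo; concat)
open import Data.List.Membership.Propositional using (_∈_)
open import Data.List.Relation.Binary.Permutation.Propositional using (_↭_)
open import Data.List.Relation.Binary.Sublist.Propositional using (_⊆_)
open import Data.Vec as Vec using (Vec)
open import Data.Product using (Σ; ∃; _×_)
open import Relation.Binary.PropositionalEquality using (_≡_)
open import Function.Bundles using (_⇔_)

IsPerm : ℕ → List ℕ → Set
IsPerm n π = π ↭ applyUpTo suc n

OrderIso : List ℕ → List ℕ → Set
OrderIso xs ys =
  Σ (length xs ≡ length ys) λ eq →
    (i j : Fin (length xs)) →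
      (lookup xs i < lookup xs j) ⇔ (lookup ys (Fin.cast eq i) < lookup ys (Fin.cast eq j))

Contains : List ℕ → List ℕ → Set
Contains π σ = ∃ λ τ → (τ ⊆ π) × OrderIso τ σ

-- A template T = (P, B) of length t ≥ 1; P a permutation of {1..t},
-- B a binary string (false = 0, true = 1).
record Template : Set where
  field
    t      : ℕ
    t≥1    : 1 ≤ t
    P      : Vec ℕ t
    P-perm : IsPerm t (Vec.toList P)
    B      : Vec Bool t
open Template public

numZeros : ∀ {n} → Vec Bool n → ℕ
numZeros Vec.[] = 0
numZeros (false Vec.∷ bs) = suc (numZeros bs)
numZeros (true Vec.∷ bs) = numZeros bs

data InR (T : Template) : List ℕ → Set where
  r-empty : InR T []
  r-one   : InR T (1 ∷ [])
  r-step  : ∀ {π : List ℕ} (W : Vec (List ℕ) (t T)) →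
    2 ≤ length π →
    IsPerm (length π) π →
    π ≡ concat (Vec.toList W) →
    (∀ (i j : Fin (t T)) → Vec.lookup (P T) i > Vec.lookup (P T) j →
       ∀ {x y} → x ∈ Vec.lookup W i → y ∈ Vec.lookup W j → x > y) →
    (∀ (i : Fin (t T)) → Vec.lookup (B T) i ≡ false → length (Vec.lookup W i) ≡ 1) →
    (∀ (i : Fin (t T)) → Σ (List ℕ) λ σ → OrderIso (Vec.lookup W i) σ × InR T σ) →
    InR T π

R : Template → ℕ → List ℕ → Set
R T n π = (length π ≡ n) × InR T π

module Submission where

-- By induction on the derivation of π ∈ R we show that every sublist τ
-- of π has a small host: a member of R of length at most (|τ|-1)(k+1)+1 that
-- contains a copy of τ (a sublist order-isomorphic to τ).  Split τ along the
-- division W₁⋯W_t of π.  If τ lies inside one block, use the induction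
-- hypothesis for that block's standardisation.  Otherwise τ meets two blocks:
-- replace each block by the small host of its part of τ (by 1 at an empty zero
-- position, by nothing at an empty one-position) and reassemble them in the
-- order given by P.  This inflation of the template is again in R.  Each
-- nonempty part costs at most (k+1)|τᵢ| - k, the empty zero positions at most k
-- in total, and two nonempty parts absorb that k, which gives the bound.

open import Defs

open import Data.Bool using (Bool; true; false)
open import Data.Empty using (⊥; ⊥-elim)
open import Data.Product using (∃; _×_; _,_; proj₁; proj₂; swap)
open import Data.Sum using (_⊎_; inj₁; inj₂)
open import Function using (_∘_)
open import Function.Bundles using (_⇔_; mk⇔; Equivalence)
open import Relation.Binary.Definitions using (tri<; tri≈; tri>)
open import Relation.Binary.PropositionalEquality
import Relation.Binary.PropositionalEquality.Properties as ≡
open import Relation.Nullary using (Dec; yes; no; ¬?; _→-dec_)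

open import Data.Nat using (ℕ; zero; suc; _+_; _*_; _∸_; _<_; _≤_; _>_; z≤n; s≤s; s≤s⁻¹; _≟_; _<?_)
open import Data.Nat.Properties
import Data.Nat.Tactic.RingSolver as RingSolver
open import Algebra.Properties.CommutativeSemigroup +-commutativeSemigroup using () renaming (interchange to +-interchange)

open import Data.Fin as Fin using (Fin)
import Data.Fin.Properties as FinP
open import Data.Vec as Vec using (Vec)
open import Data.Vec.Properties using (lookup∘tabulate)
open import Data.Vec.Functional using () renaming (_∷_ to _∷ᶠ_)
open import Data.Vec.Relation.Unary.Unique.Propositional using () renaming (Unique to VecUnique)
import Data.Vec.Relation.Unary.Unique.Propositional.Properties as VecUniqueP
import Data.Vec.Relation.Unary.AllPairs as VecAllPairs
import Data.Vec.Relation.Unary.All.Properties as VecAllP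

open import Data.List using (List; []; _∷_; _++_; length; map; concat; applyUpTo; lookup; tabulate)
open import Data.List.Properties
  using (length-map; length-++; length-applyUpTo; applyUpTo-∷ʳ; map-++; map-∘; map-id; map-cong;
         map-tabulate; tabulate-lookup; tabulate-cong; ∷-injectiveˡ; ∷-injectiveʳ; ++-identityʳ)
open import Data.List.Membership.Propositional using (_∈_; _∉_)
open import Data.List.Membership.Propositional.Properties
  using (∈-map⁻; ∈-map⁺; ∈-++⁻; ∈-tabulate⁻; ∈-applyUpTo⁻; ∈-∃++)
open import Data.List.Membership.DecPropositional _≟_ using (_∈?_)
open import Data.List.Relation.Unary.Any using (here; there)
import Data.List.Relation.Unary.All as All
import Data.List.Relation.Unary.AllPairs as AllPairs
open import Data.List.Relation.Unary.Unique.Propositional using (Unique)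
import Data.List.Relation.Unary.Unique.Propositional.Properties as UniqueP
open import Data.List.Relation.Binary.Sublist.Propositional using (_⊆_; []; _∷_; _∷ʳ_; minimum)
import Data.List.Relation.Binary.Sublist.Propositional as Sublist
open import Data.List.Relation.Binary.Sublist.Propositional.Properties using (length-mono-≤; ++⁺; map⁺)
open import Data.List.Relation.Binary.Permutation.Propositional
  using (_↭_; ↭-sym; ↭-refl; prep; ↭⇒↭ₛ; module PermutationReasoning)
open import Data.List.Relation.Binary.Permutation.Propositional.Properties using (↭-length; ∈-resp-↭; shift; ∷↭∷ʳ)
import Data.List.Relation.Binary.Permutation.Setoid.Properties as PermP

sumF : ∀ {n} → (Fin n → ℕ) → ℕ
sumF {zero}  f = 0
sumF {suc n} f = f Fin.zero + sumF (f ∘ Fin.suc)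

concatF : ∀ {n} {A : Set} → (Fin n → List A) → List A
concatF {zero}  f = []
concatF {suc n} f = f Fin.zero ++ concatF (f ∘ Fin.suc)

sumF-cong : ∀ {n} {f g : Fin n → ℕ} → (∀ i → f i ≡ g i) → sumF f ≡ sumF g
sumF-cong {zero}  e = refl
sumF-cong {suc n} e = cong₂ _+_ (e Fin.zero) (sumF-cong (e ∘ Fin.suc))

sumF-mono : ∀ {n} {f g : Fin n → ℕ} → (∀ i → f i ≤ g i) → sumF f ≤ sumF g
sumF-mono {zero}  le = z≤n
sumF-mono {suc n} le = +-mono-≤ (le Fin.zero) (sumF-mono (le ∘ Fin.suc))

sumF-+ : ∀ {n} (f g : Fin n → ℕ) → sumF (λ i → f i + g i) ≡ sumF f + sumF g
sumF-+ {zero}  f g = refl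
sumF-+ {suc n} f g = begin
  (f₀ + g₀) + sumF (λ i → f (Fin.suc i) + g (Fin.suc i)) ≡⟨ cong ((f₀ + g₀) +_) (sumF-+ (f ∘ Fin.suc) (g ∘ Fin.suc)) ⟩
  (f₀ + g₀) + (sumF (f ∘ Fin.suc) + sumF (g ∘ Fin.suc))   ≡⟨ +-interchange f₀ g₀ _ _ ⟩
  (f₀ + sumF (f ∘ Fin.suc)) + (g₀ + sumF (g ∘ Fin.suc))   ∎
  where
  open ≡-Reasoning
  f₀ g₀ : ℕ
  f₀ = f Fin.zero
  g₀ = g Fin.zero

sumF-*ʳ : ∀ {n} (f : Fin n → ℕ) c → sumF (λ i → f i * c) ≡ sumF f * c
sumF-*ʳ {zero}  f c = refl
sumF-*ʳ {suc n} f c =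
  trans (cong (f Fin.zero * c +_) (sumF-*ʳ (f ∘ Fin.suc) c)) (sym (*-distribʳ-+ c (f Fin.zero) _))

sumF-entry : ∀ {n} (f : Fin n → ℕ) i → f i ≤ sumF f
sumF-entry f Fin.zero    = m≤m+n _ _
sumF-entry f (Fin.suc i) = ≤-trans (sumF-entry (f ∘ Fin.suc) i) (m≤n+m _ _)

sumF-pair : ∀ {n} (f : Fin n → ℕ) {i j} → i ≢ j → f i + f j ≤ sumF f
sumF-pair f {Fin.zero}  {Fin.zero}  i≢j = ⊥-elim (i≢j refl)
sumF-pair f {Fin.zero}  {Fin.suc j} _   = +-monoʳ-≤ (f Fin.zero) (sumF-entry (f ∘ Fin.suc) j)
sumF-pair f {Fin.suc i} {Fin.zero}  _   =
  subst (_≤ sumF f) (+-comm (f Fin.zero) _) (+-monoʳ-≤ (f Fin.zero) (sumF-entry (f ∘ Fin.suc) i))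
sumF-pair f {Fin.suc i} {Fin.suc j} i≢j =
  ≤-trans (sumF-pair (f ∘ Fin.suc) (i≢j ∘ cong Fin.suc)) (m≤n+m _ _)

sumF-mono-margin : ∀ {n} {f g : Fin n → ℕ} j d → (∀ i → f i ≤ g i) → f j + d ≤ g j →
                   sumF f + d ≤ sumF g
sumF-mono-margin {f = f} {g} Fin.zero d le lej = begin
  f Fin.zero + sumF (f ∘ Fin.suc) + d ≡⟨ +-assoc (f Fin.zero) _ d ⟩
  f Fin.zero + (sumF (f ∘ Fin.suc) + d) ≡⟨ cong (f Fin.zero +_) (+-comm _ d) ⟩
  f Fin.zero + (d + sumF (f ∘ Fin.suc)) ≡⟨ +-assoc (f Fin.zero) d _ ⟨
  f Fin.zero + d + sumF (f ∘ Fin.suc) ≤⟨ +-mono-≤ lej (sumF-mono (le ∘ Fin.suc)) ⟩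
  g Fin.zero + sumF (g ∘ Fin.suc) ∎
  where open ≤-Reasoning
sumF-mono-margin {f = f} {g} (Fin.suc j) d le lej = begin
  f Fin.zero + sumF (f ∘ Fin.suc) + d ≡⟨ +-assoc (f Fin.zero) _ d ⟩
  f Fin.zero + (sumF (f ∘ Fin.suc) + d) ≤⟨ +-mono-≤ (le Fin.zero) (sumF-mono-margin j d (le ∘ Fin.suc) lej) ⟩
  g Fin.zero + sumF (g ∘ Fin.suc) ∎
  where open ≤-Reasoning

concatF-cong : ∀ {n} {A : Set} {f g : Fin n → List A} → (∀ i → f i ≡ g i) → concatF f ≡ concatF g
concatF-cong {zero}  e = refl
concatF-cong {suc n} e = cong₂ _++_ (e Fin.zero) (concatF-cong (e ∘ Fin.suc))

concat-toList : ∀ {n} {A : Set} (W : Vec (List A) n) → concat (Vec.toList W) ≡ concatF (Vec.lookup W)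
concat-toList Vec.[]      = refl
concat-toList (w Vec.∷ W) = cong (w ++_) (concat-toList W)

concat-tabulate : ∀ {n} {A : Set} (f : Fin n → List A) → concat (Vec.toList (Vec.tabulate f)) ≡ concatF f
concat-tabulate {zero}  f = refl
concat-tabulate {suc n} f = cong (f Fin.zero ++_) (concat-tabulate (f ∘ Fin.suc))

length-concatF : ∀ {n} {A : Set} (f : Fin n → List A) → length (concatF f) ≡ sumF (length ∘ f)
length-concatF {zero}  f = refl
length-concatF {suc n} f = trans (length-++ (f Fin.zero)) (cong (length (f Fin.zero) +_) (length-concatF (f ∘ Fin.suc)))

map-concatF : ∀ {n} {A B : Set} (g : A → B) (f : Fin n → List A) → map g (concatF f) ≡ concatF (map g ∘ f)
map-concatF {zero}  g f = refl
map-concatF {suc n} g f = trans (map-++ g (f Fin.zero) _) (cong (map g (f Fin.zero) ++_) (map-concatF g (f ∘ Fin.suc)))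

∈-concatF⁻ : ∀ {n} {A : Set} (f : Fin n → List A) {x} → x ∈ concatF f → ∃ λ i → x ∈ f i
∈-concatF⁻ {suc n} f x∈ with ∈-++⁻ (f Fin.zero) x∈
... | inj₁ x∈f₀ = Fin.zero , x∈f₀
... | inj₂ x∈rest with ∈-concatF⁻ (f ∘ Fin.suc) x∈rest
...   | i , x∈fi = Fin.suc i , x∈fi

concatF-single : ∀ {n} {A : Set} (f : Fin n → List A) i → (∀ j → j ≢ i → f j ≡ []) → concatF f ≡ f i
concatF-single {suc n} f Fin.zero others = trans (cong (f Fin.zero ++_) (all-empty (λ j → others (Fin.suc j) (λ ())))) (++-identityʳ _)
  where
  all-empty : ∀ {m} {g : Fin m → List _} → (∀ j → g j ≡ []) → concatF g ≡ []
  all-empty {zero}  e = refl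
  all-empty {suc m} e rewrite e Fin.zero = all-empty (e ∘ Fin.suc)
concatF-single {suc n} f (Fin.suc i) others rewrite others Fin.zero (λ ()) =
  concatF-single (f ∘ Fin.suc) i (λ j j≢i → others (Fin.suc j) (j≢i ∘ FinP.suc-injective))

concatF-⊆ : ∀ {n} {A : Set} {f g : Fin n → List A} → (∀ i → f i ⊆ g i) → concatF f ⊆ concatF g
concatF-⊆ {zero}  s = []
concatF-⊆ {suc n} s = ++⁺ (s Fin.zero) (concatF-⊆ (s ∘ Fin.suc))

⊆-++-split : ∀ {A : Set} (xs : List A) {ys τ : List A} → τ ⊆ xs ++ ys →
             ∃ λ a → ∃ λ b → τ ≡ a ++ b × a ⊆ xs × b ⊆ ys
⊆-++-split [] s = [] , _ , refl , [] , s
⊆-++-split (x ∷ xs) (.x ∷ʳ s) with ⊆-++-split xs s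
... | a , b , refl , a⊆ , b⊆ = a , b , refl , x ∷ʳ a⊆ , b⊆
⊆-++-split (x ∷ xs) (refl ∷ s) with ⊆-++-split xs s
... | a , b , refl , a⊆ , b⊆ = x ∷ a , b , refl , refl ∷ a⊆ , b⊆

⊆-concatF-split : ∀ {n} {A : Set} (f : Fin n → List A) {τ} → τ ⊆ concatF f →
                  ∃ λ (τs : Fin n → List A) → τ ≡ concatF τs × (∀ i → τs i ⊆ f i)
⊆-concatF-split {zero} f [] = (λ ()) , refl , λ ()
⊆-concatF-split {suc n} f s with ⊆-++-split (f Fin.zero) s
... | a , b , refl , a⊆ , b⊆ with ⊆-concatF-split (f ∘ Fin.suc) b⊆
...   | τs , refl , τs⊆ = (a ∷ᶠ τs) , refl , parts⊆
  where
  parts⊆ : ∀ i → (a ∷ᶠ τs) i ⊆ f i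
  parts⊆ Fin.zero    = a⊆
  parts⊆ (Fin.suc i) = τs⊆ i

⊆-map-preimage : ∀ {A B : Set} (f : A → B) (zs : List A) {ys} → ys ⊆ map f zs →
                 ∃ λ zs′ → zs′ ⊆ zs × map f zs′ ≡ ys
⊆-map-preimage f []       []         = [] , [] , refl
⊆-map-preimage f (z ∷ zs) (_ ∷ʳ s)   with ⊆-map-preimage f zs s
... | zs′ , zs′⊆ , refl = zs′ , z ∷ʳ zs′⊆ , refl
⊆-map-preimage f (z ∷ zs) (refl ∷ s) with ⊆-map-preimage f zs s
... | zs′ , zs′⊆ , refl = z ∷ zs′ , refl ∷ zs′⊆ , refl

-- Order similarity, as an explicit matching.  A list of pairs is coherent when
-- any two of its pairs are compared the same way in both coordinates; xs ≅ ys
-- when xs and ys are the two coordinate lists of a coherent list of pairs.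
-- This is equivalent to Defs.OrderIso (see OrderIso⇒≅ and ≅⇒OrderIso) but is
-- index-free, which makes restriction and concatenation easy to handle.

Coherent : List (ℕ × ℕ) → Set
Coherent zs = ∀ {p q} → p ∈ zs → q ∈ zs →
  (proj₁ p < proj₁ q → proj₂ p < proj₂ q) × (proj₂ p < proj₂ q → proj₁ p < proj₁ q)

infix 4 _≅_
_≅_ : List ℕ → List ℕ → Set
xs ≅ ys = ∃ λ zs → Coherent zs × map proj₁ zs ≡ xs × map proj₂ zs ≡ ys

≅-length : ∀ {xs ys} → xs ≅ ys → length xs ≡ length ys
≅-length (zs , _ , refl , refl) = trans (length-map proj₁ zs) (sym (length-map proj₂ zs))

≅-refl : ∀ xs → xs ≅ xs
≅-refl xs = map (λ x → x , x) xs , coherent , diagonal (λ _ → refl) , diagonal (λ _ → refl)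
  where
  diagonal : ∀ {π : ℕ × ℕ → ℕ} → (∀ x → π (x , x) ≡ x) → map π (map (λ x → x , x) xs) ≡ xs
  diagonal πdiag = trans (sym (map-∘ xs)) (trans (map-cong πdiag xs) (map-id xs))
  coherent : Coherent (map (λ x → x , x) xs)
  coherent p q with ∈-map⁻ _ p | ∈-map⁻ _ q
  ... | _ , _ , refl | _ , _ , refl = (λ lt → lt) , (λ lt → lt)

≅-sym : ∀ {xs ys} → xs ≅ ys → ys ≅ xs
≅-sym (zs , coh , refl , refl) = map swap zs , coherent , sym (map-∘ zs) , sym (map-∘ zs)
  where
  coherent : Coherent (map swap zs)
  coherent p q with ∈-map⁻ swap p | ∈-map⁻ swap q
  ... | _ , p′ , refl | _ , q′ , refl = swap (coh p′ q′)

compose : List (ℕ × ℕ) → List (ℕ × ℕ) → List (ℕ × ℕ)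
compose (z ∷ zs) (w ∷ ws) = (proj₁ z , proj₂ w) ∷ compose zs ws
compose _        _        = []

private
  compose₁ : ∀ zs ws → map proj₂ zs ≡ map proj₁ ws → map proj₁ (compose zs ws) ≡ map proj₁ zs
  compose₁ []       []       e = refl
  compose₁ (z ∷ zs) (w ∷ ws) e = cong (proj₁ z ∷_) (compose₁ zs ws (∷-injectiveʳ e))

  compose₂ : ∀ zs ws → map proj₂ zs ≡ map proj₁ ws → map proj₂ (compose zs ws) ≡ map proj₂ ws
  compose₂ []       []       e = refl
  compose₂ (z ∷ zs) (w ∷ ws) e = cong (proj₂ w ∷_) (compose₂ zs ws (∷-injectiveʳ e))

  compose-∈ : ∀ zs ws → map proj₂ zs ≡ map proj₁ ws → ∀ {p} → p ∈ compose zs ws →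
              ∃ λ b → (proj₁ p , b) ∈ zs × (b , proj₂ p) ∈ ws
  compose-∈ (z ∷ zs) (w ∷ ws) e (here refl) = proj₂ z , here refl , here (cong (_, proj₂ w) (∷-injectiveˡ e))
  compose-∈ (z ∷ zs) (w ∷ ws) e (there p) with compose-∈ zs ws (∷-injectiveʳ e) p
  ... | b , p₁ , p₂ = b , there p₁ , there p₂

≅-trans : ∀ {xs ys vs} → xs ≅ ys → ys ≅ vs → xs ≅ vs
≅-trans (zs , coh , refl , e) (ws , coh′ , e′ , refl) =
  compose zs ws , coherent , compose₁ zs ws mid , compose₂ zs ws mid
  where
  mid : map proj₂ zs ≡ map proj₁ ws
  mid = trans e (sym e′)
  coherent : Coherent (compose zs ws)
  coherent p q with compose-∈ zs ws mid p | compose-∈ zs ws mid q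
  ... | _ , p₁ , p₂ | _ , q₁ , q₂ =
    (proj₁ (coh′ p₂ q₂) ∘ proj₁ (coh p₁ q₁)) , (proj₂ (coh p₁ q₁) ∘ proj₂ (coh′ p₂ q₂))

≅-restrict : ∀ {xs ys xs′} → xs ≅ ys → xs′ ⊆ xs → ∃ λ ys′ → ys′ ⊆ ys × xs′ ≅ ys′
≅-restrict (zs , coh , refl , refl) s with ⊆-map-preimage proj₁ zs s
... | zs′ , zs′⊆ , e =
  map proj₂ zs′ , map⁺ proj₂ zs′⊆ , zs′ , (λ p q → coh (Sublist.lookup zs′⊆ p) (Sublist.lookup zs′⊆ q)) , e , refl

≅-shift : ∀ c {xs ys} → xs ≅ ys → map (_+ c) xs ≅ ys
≅-shift c (zs , coh , refl , refl) = map translate zs , coherent , trans (sym (map-∘ zs)) (map-∘ zs) , sym (map-∘ zs)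
  where
  translate : ℕ × ℕ → ℕ × ℕ
  translate (a , b) = a + c , b
  coherent : Coherent (map translate zs)
  coherent p q with ∈-map⁻ translate p | ∈-map⁻ translate q
  ... | _ , p′ , refl | _ , q′ , refl =
    (proj₁ (coh p′ q′) ∘ +-cancelʳ-< _ _ _) , (+-monoˡ-< c ∘ proj₂ (coh p′ q′))

OrderIso⇒≅ : ∀ {xs ys} → OrderIso xs ys → xs ≅ ys
OrderIso⇒≅ {xs} {ys} (e , iso) = zs , coherent , first , second
  where
  zs : List (ℕ × ℕ)
  zs = tabulate (λ i → lookup xs i , lookup ys (Fin.cast e i))
  coherent : Coherent zs
  coherent p q with ∈-tabulate⁻ p | ∈-tabulate⁻ q
  ... | i , refl | j , refl = Equivalence.to (iso i j) , Equivalence.from (iso i j)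
  first : map proj₁ zs ≡ xs
  first = trans (map-tabulate _ proj₁) (tabulate-lookup xs)
  tabulate-lookup-cast : ∀ {n} (e′ : n ≡ length ys) → tabulate (lookup ys ∘ Fin.cast e′) ≡ ys
  tabulate-lookup-cast refl = trans (tabulate-cong (cong (lookup ys) ∘ FinP.cast-is-id refl)) (tabulate-lookup ys)
  second : map proj₂ zs ≡ ys
  second = trans (map-tabulate _ proj₂) (tabulate-lookup-cast e)

≅⇒OrderIso : ∀ {xs ys} → xs ≅ ys → OrderIso xs ys
≅⇒OrderIso (zs , coh , refl , refl) = len , λ i j → compare i j
  where
  len : length (map proj₁ zs) ≡ length (map proj₂ zs)
  len = trans (length-map proj₁ zs) (sym (length-map proj₂ zs))
  entry : ∀ (zs : List (ℕ × ℕ)) (i : Fin (length (map proj₁ zs))) (e : length (map proj₁ zs) ≡ length (map proj₂ zs)) →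
          ∃ λ p → p ∈ zs × lookup (map proj₁ zs) i ≡ proj₁ p × lookup (map proj₂ zs) (Fin.cast e i) ≡ proj₂ p
  entry (z ∷ zs) Fin.zero    e = z , here refl , refl , refl
  entry (z ∷ zs) (Fin.suc i) e with entry zs i (suc-injective e)
  ... | p , p∈ , e₁ , e₂ = p , there p∈ , e₁ , e₂
  compare : ∀ i j → (lookup (map proj₁ zs) i < lookup (map proj₁ zs) j) ⇔
                    (lookup (map proj₂ zs) (Fin.cast len i) < lookup (map proj₂ zs) (Fin.cast len j))
  compare i j with entry zs i len | entry zs j len
  ... | p , p∈ , pi₁ , pi₂ | q , q∈ , qj₁ , qj₂ rewrite pi₁ | pi₂ | qj₁ | qj₂ = mk⇔ (proj₁ (coh p∈ q∈)) (proj₂ (coh p∈ q∈))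

≅-concatF : ∀ {n} (f g : Fin n → List ℕ) → (∀ l → f l ≅ g l) →
  (∀ a b → a ≢ b → ∀ {x y u v} → x ∈ f a → y ∈ f b → u ∈ g a → v ∈ g b →
     (x < y → u < v) × (u < v → x < y)) →
  concatF f ≅ concatF g
≅-concatF {n} f g sim cross = concatF matching , coherent , firsts , seconds
  where
  matching : Fin n → List (ℕ × ℕ)
  matching l = proj₁ (sim l)
  firsts : map proj₁ (concatF matching) ≡ concatF f
  firsts = trans (map-concatF proj₁ matching) (concatF-cong (λ l → proj₁ (proj₂ (proj₂ (sim l)))))
  seconds : map proj₂ (concatF matching) ≡ concatF g
  seconds = trans (map-concatF proj₂ matching) (concatF-cong (λ l → proj₂ (proj₂ (proj₂ (sim l)))))
  first∈ : ∀ l {p} → p ∈ matching l → proj₁ p ∈ f l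
  first∈ l p∈ = subst (_ ∈_) (proj₁ (proj₂ (proj₂ (sim l)))) (∈-map⁺ proj₁ p∈)
  second∈ : ∀ l {p} → p ∈ matching l → proj₂ p ∈ g l
  second∈ l p∈ = subst (_ ∈_) (proj₂ (proj₂ (proj₂ (sim l)))) (∈-map⁺ proj₂ p∈)
  coherent : Coherent (concatF matching)
  coherent p q with ∈-concatF⁻ matching p | ∈-concatF⁻ matching q
  ... | a , pa | b , qb with a Fin.≟ b
  ... | yes refl = proj₁ (proj₂ (sim a)) pa qb
  ... | no a≢b   = cross a b a≢b (first∈ a pa) (first∈ b qb) (second∈ a pa) (second∈ b qb)

Bounded : ℕ → List ℕ → Set
Bounded n xs = ∀ {x} → x ∈ xs → 0 < x × x ≤ n

perm-unique : ∀ {n xs} → IsPerm n xs → Unique xs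
perm-unique {n} p = PermP.Unique-resp-↭ (≡.setoid ℕ) (↭⇒↭ₛ (↭-sym p))
  (UniqueP.applyUpTo⁺₁ suc n (λ i<j _ → <⇒≢ i<j ∘ suc-injective))

perm-bounded : ∀ {n xs} → IsPerm n xs → Bounded n xs
perm-bounded p x∈ with ∈-applyUpTo⁻ suc (∈-resp-↭ p x∈)
... | _ , i<n , refl = s≤s z≤n , i<n

perm-length : ∀ {n xs} → IsPerm n xs → length xs ≡ n
perm-length {n} p = trans (↭-length p) (length-applyUpTo suc n)

private
  lower : ∀ {n xs} → Bounded (suc n) xs → suc n ∉ xs → Bounded n xs
  lower {n} b n∉ {x} x∈ with b x∈
  ... | x>0 , x≤ = x>0 , ≤-pred (≤∧≢⇒< x≤ (λ { refl → n∉ x∈ }))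

  remove-max : ∀ {n xs} → Unique xs → Bounded (suc n) xs → suc n ∈ xs →
               ∃ λ ys → xs ↭ suc n ∷ ys × Unique ys × Bounded n ys
  remove-max {n} u b n∈ with ∈-∃++ n∈
  ... | as , bs , refl = as ++ bs , moved , unique-ys , lower bounded-ys n∉ys
    where
    moved : as ++ suc n ∷ bs ↭ suc n ∷ as ++ bs
    moved = shift (suc n) as bs
    unique-n∷ys : Unique (suc n ∷ as ++ bs)
    unique-n∷ys = PermP.Unique-resp-↭ (≡.setoid ℕ) (↭⇒↭ₛ moved) u
    unique-ys : Unique (as ++ bs)
    unique-ys = AllPairs.tail unique-n∷ys
    n∉ys : suc n ∉ as ++ bs
    n∉ys n∈ys = All.lookup (AllPairs.head unique-n∷ys) n∈ys refl
    bounded-ys : Bounded (suc n) (as ++ bs)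
    bounded-ys y∈ = b (∈-resp-↭ (↭-sym moved) (there y∈))

unique-bounded-length : ∀ n {xs} → Unique xs → Bounded n xs → length xs ≤ n
unique-bounded-length zero    {[]}    u b = z≤n
unique-bounded-length zero    {x ∷ _} u b = ⊥-elim (<⇒≱ (proj₁ (b (here refl))) (proj₂ (b (here refl))))
unique-bounded-length (suc n) {xs}    u b with suc n ∈? xs
... | no  n∉ = m≤n⇒m≤1+n (unique-bounded-length n u (lower b n∉))
... | yes n∈ with remove-max u b n∈
...   | ys , xs↭ , u′ , b′ = subst (_≤ suc n) (sym (↭-length xs↭)) (s≤s (unique-bounded-length n u′ b′))

unique-bounded-perm : ∀ n {xs} → Unique xs → Bounded n xs → length xs ≡ n → IsPerm n xs
unique-bounded-perm zero    {[]} u b len = ↭-refl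
unique-bounded-perm (suc n) {xs} u b len with suc n ∈? xs
... | no  n∉ = ⊥-elim (<⇒≱ (≤-reflexive (sym len)) (unique-bounded-length n u (lower b n∉)))
... | yes n∈ with remove-max u b n∈
...   | ys , xs↭ , u′ , b′ = begin
  xs                              ↭⟨ xs↭ ⟩
  suc n ∷ ys                      ↭⟨ prep (suc n) (unique-bounded-perm n u′ b′ len′) ⟩
  suc n ∷ applyUpTo suc n         ↭⟨ ∷↭∷ʳ (suc n) (applyUpTo suc n) ⟩
  applyUpTo suc n ++ suc n ∷ []   ≡⟨ applyUpTo-∷ʳ suc n ⟩
  applyUpTo suc (suc n)           ∎
  where
  open PermutationReasoning
  len′ : length ys ≡ n
  len′ = suc-injective (trans (sym (↭-length xs↭)) len)

unique-concatF : ∀ {n} (f : Fin n → List ℕ) → (∀ l → Unique (f l)) →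
  (∀ a b → a ≢ b → ∀ {x} → x ∈ f a → x ∈ f b → ⊥) → Unique (concatF f)
unique-concatF {zero}  f u disj = AllPairs.[]
unique-concatF {suc n} f u disj =
  UniqueP.++⁺ (u Fin.zero)
    (unique-concatF (f ∘ Fin.suc) (u ∘ Fin.suc) (λ a b a≢b → disj (Fin.suc a) (Fin.suc b) (a≢b ∘ FinP.suc-injective)))
    (λ { (x∈f₀ , x∈rest) → let (b , x∈fb) = ∈-concatF⁻ (f ∘ Fin.suc) x∈rest in disj Fin.zero (Fin.suc b) (λ ()) x∈f₀ x∈fb })

InR-perm : ∀ {T π} → InR T π → IsPerm (length π) π
InR-perm r-empty                   = ↭-refl
InR-perm r-one                     = ↭-refl
InR-perm (r-step _ _ perm _ _ _ _) = perm

isZero : Bool → ℕ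
isZero false = 1
isZero true  = 0

numZeros-sumF : ∀ {n} (b : Vec Bool n) → numZeros b ≡ sumF (isZero ∘ Vec.lookup b)
numZeros-sumF Vec.[]           = refl
numZeros-sumF (false Vec.∷ b) = cong suc (numZeros-sumF b)
numZeros-sumF (true  Vec.∷ b) = numZeros-sumF b

P-injective : ∀ T (a b : Fin (t T)) → Vec.lookup (P T) a ≡ Vec.lookup (P T) b → a ≡ b
P-injective T = VecUniqueP.lookup-injective (fromList-unique (perm-unique (P-perm T)))
  where
  fromList-unique : ∀ {n} {v : Vec ℕ n} → Unique (Vec.toList v) → VecUnique v
  fromList-unique {v = Vec.[]}    _ = VecAllPairs.[]
  fromList-unique {v = x Vec.∷ v} u =
    VecAllP.toList⁻ (AllPairs.head u) VecAllPairs.∷ fromList-unique (AllPairs.tail u)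

-- v counted only when a < c: used to add up the widths of the blocks that lie
-- below a given block in the order prescribed by P.
countIfBelow : ℕ → ℕ → ℕ → ℕ
countIfBelow a c v with a <? c
... | yes _ = v
... | no  _ = 0

countIfBelow-≤ : ∀ a c v → countIfBelow a c v ≤ v
countIfBelow-≤ a c v with a <? c
... | yes _ = ≤-refl
... | no  _ = z≤n

countIfBelow-mono : ∀ a {c c′} v → c ≤ c′ → countIfBelow a c v ≤ countIfBelow a c′ v
countIfBelow-mono a {c} {c′} v c≤c′ with a <? c | a <? c′
... | yes _   | yes _    = ≤-refl
... | yes a<c | no  a≮c′ = ⊥-elim (a≮c′ (<-≤-trans a<c c≤c′))
... | no  _   | _        = z≤n

countIfBelow-self : ∀ a v → countIfBelow a a v ≡ 0
countIfBelow-self a v with a <? a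
... | yes a<a = ⊥-elim (<-irrefl refl a<a)
... | no  _   = refl

countIfBelow-< : ∀ a c v → a < c → countIfBelow a c v ≡ v
countIfBelow-< a c v a<c with a <? c
... | yes _   = refl
... | no  a≮c = ⊥-elim (a≮c a<c)

-- Inflation of a template.  The result is a permutation whose blocks are
-- ordered as P prescribes, hence (under the size conditions of R) again in R.
module Inflation (T : Template) (blocks : Fin (t T) → List ℕ) (blocks-R : ∀ l → InR T (blocks l)) where

  rank : Fin (t T) → ℕ
  rank = Vec.lookup (P T)

  width : Fin (t T) → ℕ
  width l = length (blocks l)

  offset : Fin (t T) → ℕ
  offset l = sumF (λ m → countIfBelow (rank m) (rank l) (width m))

  shifted : Fin (t T) → List ℕ
  shifted l = map (_+ offset l) (blocks l)

  inflation : List ℕ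
  inflation = concatF shifted

  offset-gap : ∀ a b → rank a > rank b → offset b + width b ≤ offset a
  offset-gap a b a>b = sumF-mono-margin b (width b)
    (λ m → countIfBelow-mono (rank m) (width m) (<⇒≤ a>b))
    (subst₂ _≤_ (cong (_+ width b) (sym (countIfBelow-self (rank b) (width b))))
                (sym (countIfBelow-< (rank b) (rank a) (width b) a>b)) ≤-refl)

  offset-total : ∀ a → offset a + width a ≤ sumF width
  offset-total a = sumF-mono-margin a (width a)
    (λ m → countIfBelow-≤ (rank m) (rank a) (width m))
    (≤-reflexive (cong (_+ width a) (countIfBelow-self (rank a) (width a))))

  shifted-entry : ∀ l {y} → y ∈ shifted l → ∃ λ a → (0 < a × a ≤ width l) × y ≡ a + offset l
  shifted-entry l y∈ with ∈-map⁻ (_+ offset l) y∈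
  ... | a , a∈ , refl = a , perm-bounded (InR-perm (blocks-R l)) a∈ , refl

  shifted-above : ∀ a b → rank a > rank b → ∀ {y z} → y ∈ shifted a → z ∈ shifted b → y > z
  shifted-above a b a>b y∈ z∈ with shifted-entry a y∈ | shifted-entry b z∈
  ... | u , (u>0 , _) , refl | v , (_ , v≤) , refl = begin-strict
    v + offset b     ≡⟨ +-comm v (offset b) ⟩
    offset b + v     ≤⟨ +-monoʳ-≤ (offset b) v≤ ⟩
    offset b + width b ≤⟨ offset-gap a b a>b ⟩
    offset a         <⟨ m<n+m (offset a) u>0 ⟩
    u + offset a     ∎
    where open ≤-Reasoning

  inflation-length : length inflation ≡ sumF width
  inflation-length = trans (length-concatF shifted) (sumF-cong (λ l → length-map (_+ offset l) (blocks l)))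

  inflation-perm : IsPerm (length inflation) inflation
  inflation-perm = unique-bounded-perm (length inflation) unique
    (subst (λ n → Bounded n inflation) (sym inflation-length) bounded) refl
    where
    disjoint : ∀ a b → a ≢ b → ∀ {x} → x ∈ shifted a → x ∈ shifted b → ⊥
    disjoint a b a≢b xa xb with <-cmp (rank a) (rank b)
    ... | tri< a<b _ _ = <-irrefl refl (shifted-above b a a<b xb xa)
    ... | tri≈ _ a=b _ = a≢b (P-injective T a b a=b)
    ... | tri> _ _ a>b = <-irrefl refl (shifted-above a b a>b xa xb)
    unique : Unique inflation
    unique = unique-concatF shifted
      (λ l → UniqueP.map⁺ (+-cancelʳ-≡ _ _ _) (perm-unique (InR-perm (blocks-R l)))) disjoint
    bounded : Bounded (sumF width) inflation
    bounded x∈ with ∈-concatF⁻ shifted x∈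
    ... | l , x∈l with shifted-entry l x∈l
    ...   | a , (a>0 , a≤) , refl = <-≤-trans a>0 (m≤m+n a (offset l)) , (begin
      a + offset l     ≡⟨ +-comm a (offset l) ⟩
      offset l + a     ≤⟨ +-monoʳ-≤ (offset l) a≤ ⟩
      offset l + width l ≤⟨ offset-total l ⟩
      sumF width       ∎)
      where open ≤-Reasoning

  inflation-R : (∀ l → Vec.lookup (B T) l ≡ false → width l ≡ 1) → 2 ≤ sumF width → InR T inflation
  inflation-R singles two = r-step (Vec.tabulate shifted)
    (subst (2 ≤_) (sym inflation-length) two) inflation-perm (sym (concat-tabulate shifted))
    (λ a b a>b xa yb → shifted-above a b a>b (subst (_ ∈_) (tab a) xa) (subst (_ ∈_) (tab b) yb))
    (λ l l≡0 → trans (cong length (tab l)) (trans (length-map _ (blocks l)) (singles l l≡0)))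
    (λ l → blocks l , subst (λ W → OrderIso W (blocks l)) (sym (tab l)) (≅⇒OrderIso (≅-shift (offset l) (≅-refl (blocks l))))
                    , blocks-R l)
    where
    tab : ∀ l → Vec.lookup (Vec.tabulate shifted) l ≡ shifted l
    tab = lookup∘tabulate shifted

-- Size accounting for the inflation step.  A block holding a nonempty part of
-- the pattern pays k extra; since at least two blocks are nonempty, the
-- surplus k of the zero positions is absorbed and the bound (L-1)(k+1)+1 holds.

nonempty : List ℕ → ℕ
nonempty []      = 0
nonempty (_ ∷ _) = 1

nonempty-≢[] : ∀ τ → τ ≢ [] → nonempty τ ≡ 1
nonempty-≢[] []      τ≢[] = ⊥-elim (τ≢[] refl)
nonempty-≢[] (_ ∷ _) _    = refl

length-≢[] : ∀ (τ : List ℕ) → τ ≢ [] → 1 ≤ length τ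
length-≢[] []      τ≢[] = ⊥-elim (τ≢[] refl)
length-≢[] (_ ∷ _) _    = s≤s z≤n

nonempty-budget : ∀ k a L z → a ≤ L * (k + 1) + 1 → a + k * 1 ≤ suc L * (k + 1) + z
nonempty-budget k a L z a≤ = begin
  a + k * 1                 ≤⟨ +-monoˡ-≤ (k * 1) a≤ ⟩
  L * (k + 1) + 1 + k * 1   ≡⟨ regroup L k ⟩
  suc L * (k + 1)           ≤⟨ m≤m+n _ z ⟩
  suc L * (k + 1) + z       ∎
  where
  open ≤-Reasoning
  regroup : ∀ L k → L * (k + 1) + 1 + k * 1 ≡ suc L * (k + 1)
  regroup = RingSolver.solve-∀

surplus-absorbed : ∀ S L k → S + (k * 1 + k * 1) ≤ L * (k + 1) + k → S ≤ (L ∸ 1) * (k + 1) + 1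
surplus-absorbed S zero    k h = +-cancelʳ-≤ (k * 1 + k * 1) S 1 (≤-trans h small)
  where
  small : k ≤ 1 + (k * 1 + k * 1)
  small = ≤-trans (≤-reflexive (sym (*-identityʳ k))) (≤-trans (m≤m+n (k * 1) (k * 1)) (m≤n+m _ 1))
surplus-absorbed S (suc L) k h = +-cancelʳ-≤ (k * 1 + k * 1) S _ (subst (S + (k * 1 + k * 1) ≤_) (eq L k) h)
  where
  eq : ∀ L k → suc L * (k + 1) + k ≡ L * (k + 1) + 1 + (k * 1 + k * 1)
  eq = RingSolver.solve-∀

inflation-budget : ∀ {n} k (w z : Fin n → ℕ) (τs : Fin n → List ℕ) → sumF z ≡ k →
  (∀ l → w l + k * nonempty (τs l) ≤ length (τs l) * (k + 1) + z l) →
  ∀ {i j} → i ≢ j → τs i ≢ [] → τs j ≢ [] →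
  sumF w ≤ (length (concatF τs) ∸ 1) * (k + 1) + 1
inflation-budget k w z τs Σz≡k budget {i} {j} i≢j τi≢[] τj≢[] =
  surplus-absorbed (sumF w) (length (concatF τs)) k (begin
    sumF w + (k * 1 + k * 1)                       ≤⟨ +-monoʳ-≤ (sumF w) two-nonempty ⟩
    sumF w + sumF (λ l → k * nonempty (τs l))       ≡⟨ sumF-+ w _ ⟨
    sumF (λ l → w l + k * nonempty (τs l))          ≤⟨ sumF-mono budget ⟩
    sumF (λ l → length (τs l) * (k + 1) + z l)      ≡⟨ sumF-+ _ z ⟩
    sumF (λ l → length (τs l) * (k + 1)) + sumF z   ≡⟨ cong₂ _+_ (sumF-*ʳ (length ∘ τs) (k + 1)) Σz≡k ⟩
    sumF (length ∘ τs) * (k + 1) + k                ≡⟨ cong (λ L → L * (k + 1) + k) (length-concatF τs) ⟨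
    length (concatF τs) * (k + 1) + k               ∎)
  where
  open ≤-Reasoning
  two-nonempty : k * 1 + k * 1 ≤ sumF (λ l → k * nonempty (τs l))
  two-nonempty = subst₂ (λ p q → k * p + k * q ≤ _) (nonempty-≢[] (τs i) τi≢[]) (nonempty-≢[] (τs j) τj≢[])
    (sumF-pair (λ l → k * nonempty (τs l)) i≢j)

same-order : ∀ {x y u v : ℕ} → (x < y × u < v) ⊎ (y < x × v < u) → (x < y → u < v) × (u < v → x < y)
same-order (inj₁ (x<y , u<v)) = (λ _ → u<v) , (λ _ → x<y)
same-order (inj₂ (y<x , v<u)) = (λ x<y → ⊥-elim (<-asym x<y y<x)) , (λ u<v → ⊥-elim (<-asym u<v v<u))

≡[]? : ∀ {A : Set} (xs : List A) → Dec (xs ≡ [])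
≡[]? []      = yes refl
≡[]? (_ ∷ _) = no (λ ())

lone-or-spread : ∀ {n} {A : Set} (f : Fin n → List A) i →
  (∀ j → j ≢ i → f j ≡ []) ⊎ (∃ λ j → j ≢ i × f j ≢ [])
lone-or-spread {n} f i = decide (FinP.all? lone?)
  where
  lone? : ∀ j → Dec (j ≢ i → f j ≡ [])
  lone? j = ¬? (j Fin.≟ i) →-dec ≡[]? (f j)
  decide : Dec (∀ j → j ≢ i → f j ≡ []) → (∀ j → j ≢ i → f j ≡ []) ⊎ (∃ λ j → j ≢ i × f j ≢ [])
  decide (yes lone) = inj₁ lone
  decide (no ¬lone) with FinP.¬∀⟶∃¬ n _ lone? ¬lone
  ... | j , ¬lone-j = inj₂ (j , (λ j≡i → ¬lone-j (λ j≢i → ⊥-elim (j≢i j≡i))) , (λ fj≡[] → ¬lone-j (λ _ → fj≡[])))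

module Shrinking (T : Template) where

  k : ℕ
  k = numZeros (B T)

  bound : ℕ → ℕ
  bound L = (L ∸ 1) * (k + 1) + 1

  SmallHost : List ℕ → Set
  SmallHost τ = ∃ λ π → InR T π × length π ≤ bound (length τ) × ∃ λ ρ → ρ ⊆ π × ρ ≅ τ

  SmallHost-≅ : ∀ {τ τ′} → τ ≅ τ′ → SmallHost τ′ → SmallHost τ
  SmallHost-≅ τ≅τ′ (π , π∈R , π≤ , ρ , ρ⊆ , ρ≅) =
    π , π∈R , subst (λ L → length π ≤ bound L) (sym (≅-length τ≅τ′)) π≤ , ρ , ρ⊆ , ≅-trans ρ≅ (≅-sym τ≅τ′)

  record BlockHost (τ : List ℕ) (b : Bool) : Set where
    field
      host copy : List ℕ
      host-R    : InR T host
      copy⊆     : copy ⊆ host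
      copy≅     : copy ≅ τ
      budget    : length host + k * nonempty τ ≤ length τ * (k + 1) + isZero b
      single    : b ≡ false → length host ≡ 1

  blockHost : ∀ {τ W} b → SmallHost τ → τ ⊆ W → (b ≡ false → length W ≡ 1) → BlockHost τ b
  blockHost {[]} false _ _ _ = record
    { host = 1 ∷ [] ; copy = [] ; host-R = r-one ; copy⊆ = minimum _ ; copy≅ = ≅-refl []
    ; budget = s≤s (≤-reflexive (*-zeroʳ k)) ; single = λ _ → refl }
  blockHost {[]} true _ _ _ = record
    { host = [] ; copy = [] ; host-R = r-empty ; copy⊆ = [] ; copy≅ = ≅-refl []
    ; budget = ≤-reflexive (*-zeroʳ k) ; single = λ () }
  blockHost {x ∷ τ} b (π , π∈R , π≤ , ρ , ρ⊆ , ρ≅) τ⊆W W-single = record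
    { host = π ; copy = ρ ; host-R = π∈R ; copy⊆ = ρ⊆ ; copy≅ = ρ≅
    ; budget = nonempty-budget k (length π) (length τ) (isZero b) π≤ ; single = single }
    where
    single : b ≡ false → length π ≡ 1
    single b≡0 = ≤-antisym (subst (λ L → length π ≤ L * (k + 1) + 1) τ-empty π≤) (≤-trans (s≤s z≤n) τ≤π)
      where
      τ-empty : length τ ≡ 0
      τ-empty = n≤0⇒n≡0 (s≤s⁻¹ (subst (length (x ∷ τ) ≤_) (W-single b≡0) (length-mono-≤ τ⊆W)))
      τ≤π : length (x ∷ τ) ≤ length π
      τ≤π = subst (_≤ length π) (≅-length ρ≅) (length-mono-≤ ρ⊆)

  AboveByP : Vec (List ℕ) (t T) → Set
  AboveByP W = ∀ (i j : Fin (t T)) → Vec.lookup (P T) i > Vec.lookup (P T) j →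
               ∀ {x y} → x ∈ Vec.lookup W i → y ∈ Vec.lookup W j → x > y

  SinglesAtZeros : Vec (List ℕ) (t T) → Set
  SinglesAtZeros W = ∀ (i : Fin (t T)) → Vec.lookup (B T) i ≡ false → length (Vec.lookup W i) ≡ 1

  spread : ∀ W → AboveByP W → SinglesAtZeros W →
    ∀ (τs : Fin (t T) → List ℕ) → (∀ l → τs l ⊆ Vec.lookup W l) → (∀ l → SmallHost (τs l)) →
    ∀ {i j} → i ≢ j → τs i ≢ [] → τs j ≢ [] → SmallHost (concatF τs)
  spread W above singles τs τs⊆ hosts i≢j τi≢[] τj≢[] =
    inflation , inflation-R (single ∘ blk) two , size , copies , copies⊆ , copies≅
    where
    blk : ∀ l → BlockHost (τs l) (Vec.lookup (B T) l)
    blk l = blockHost (Vec.lookup (B T) l) (hosts l) (τs⊆ l) (singles l)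
    open BlockHost
    open Inflation T (host ∘ blk) (host-R ∘ blk)

    nonempty-width : ∀ l → τs l ≢ [] → 1 ≤ width l
    nonempty-width l τl≢[] = ≤-trans (length-≢[] (τs l) τl≢[])
      (subst (_≤ width l) (≅-length (copy≅ (blk l))) (length-mono-≤ (copy⊆ (blk l))))

    two : 2 ≤ sumF width
    two = ≤-trans (+-mono-≤ (nonempty-width _ τi≢[]) (nonempty-width _ τj≢[])) (sumF-pair width i≢j)

    size : length inflation ≤ bound (length (concatF τs))
    size = subst (_≤ bound (length (concatF τs))) (sym inflation-length)
      (inflation-budget k width (isZero ∘ Vec.lookup (B T)) τs (sym (numZeros-sumF (B T))) (budget ∘ blk) i≢j τi≢[] τj≢[])

    shiftedCopy : Fin (t T) → List ℕ
    shiftedCopy l = map (_+ offset l) (copy (blk l))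

    copies : List ℕ
    copies = concatF shiftedCopy

    copies⊆ : copies ⊆ inflation
    copies⊆ = concatF-⊆ (λ l → map⁺ (_+ offset l) (copy⊆ (blk l)))

    copies≅ : copies ≅ concatF τs
    copies≅ = ≅-concatF shiftedCopy τs (λ l → ≅-shift (offset l) (copy≅ (blk l))) cross
      where
      inShifted : ∀ l {x} → x ∈ shiftedCopy l → x ∈ shifted l
      inShifted l = Sublist.lookup (map⁺ (_+ offset l) (copy⊆ (blk l)))
      inW : ∀ l {u} → u ∈ τs l → u ∈ Vec.lookup W l
      inW l = Sublist.lookup (τs⊆ l)
      cross : ∀ a b → a ≢ b → ∀ {x y u v} → x ∈ shiftedCopy a → y ∈ shiftedCopy b → u ∈ τs a → v ∈ τs b →
              (x < y → u < v) × (u < v → x < y)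
      cross a b a≢b x∈ y∈ u∈ v∈ with <-cmp (rank a) (rank b)
      ... | tri< a<b _ _ = same-order (inj₁ (shifted-above b a a<b (inShifted b y∈) (inShifted a x∈) ,
                                             above b a a<b (inW b v∈) (inW a u∈)))
      ... | tri≈ _ a=b _ = ⊥-elim (a≢b (P-injective T a b a=b))
      ... | tri> _ _ a>b = same-order (inj₂ (shifted-above a b a>b (inShifted a x∈) (inShifted b y∈) ,
                                             above a b a>b (inW a u∈) (inW b v∈)))

  -- A pattern inside a single block is handled in the block's
  -- standardisation; a pattern meeting two blocks by the inflation step.
  shrink : ∀ {π} → InR T π → ∀ τ → τ ⊆ π → SmallHost τ
  shrink _     []      _  = [] , r-empty , z≤n , [] , [] , ≅-refl []
  shrink r-one (x ∷ τ) τ⊆ = (1 ∷ []) , r-one , m≤n+m 1 _ , x ∷ τ , τ⊆ , ≅-refl (x ∷ τ)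
  shrink (r-step W _ _ refl above singles parts) (x ∷ τ) τ⊆ =
    subst SmallHost (sym τ≡) (combine (lone-or-spread τs i))
    where
    split : ∃ λ (τs : Fin (t T) → List ℕ) → x ∷ τ ≡ concatF τs × (∀ l → τs l ⊆ Vec.lookup W l)
    split = ⊆-concatF-split (Vec.lookup W) (subst ((x ∷ τ) ⊆_) (concat-toList W) τ⊆)
    τs : Fin (t T) → List ℕ
    τs = proj₁ split
    τ≡ : x ∷ τ ≡ concatF τs
    τ≡ = proj₁ (proj₂ split)
    τs⊆ : ∀ l → τs l ⊆ Vec.lookup W l
    τs⊆ = proj₂ (proj₂ split)

    first : ∃ λ i → x ∈ τs i
    first = ∈-concatF⁻ τs (subst (x ∈_) τ≡ (here refl))
    i : Fin (t T)
    i = proj₁ first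
    τi≢[] : τs i ≢ []
    τi≢[] τi≡[] with subst (x ∈_) τi≡[] (proj₂ first)
    ... | ()

    blockHosts : ∀ l → SmallHost (τs l)
    blockHosts l with parts l
    ... | σ , Wl≅σ , σ∈R with ≅-restrict (OrderIso⇒≅ Wl≅σ) (τs⊆ l)
    ...   | τ′ , τ′⊆σ , τl≅τ′ = SmallHost-≅ τl≅τ′ (shrink σ∈R τ′ τ′⊆σ)

    combine : (∀ j → j ≢ i → τs j ≡ []) ⊎ (∃ λ j → j ≢ i × τs j ≢ []) → SmallHost (concatF τs)
    combine (inj₁ lone)              = subst SmallHost (sym (concatF-single τs i lone)) (blockHosts i)
    combine (inj₂ (j , j≢i , τj≢[])) = spread W above singles τs τs⊆ blockHosts j≢i τj≢[] τi≢[]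

theorem5 : (T : Template) (k : ℕ) → numZeros (B T) ≡ k →
    (l : ℕ) (σ : List ℕ) → 0 < l → IsPerm l σ →
    (∃ λ n → ∃ λ π → R T n π × Contains π σ) →
    ∃ λ m → (m ≤ (l ∸ 1) * (k + 1) + 1) × (∃ λ π → R T m π × Contains π σ)
theorem5 T k zeros l σ _ σ-perm (_ , π , (_ , π∈R) , τ , τ⊆π , τ≅σ)
  with Shrinking.shrink T π∈R τ τ⊆π
... | π′ , π′∈R , π′-small , ρ , ρ⊆π′ , ρ≅τ =
  length π′ , small , π′ , (refl , π′∈R) , ρ , ρ⊆π′ , ≅⇒OrderIso (≅-trans ρ≅τ (OrderIso⇒≅ {τ} {σ} τ≅σ))
  where
  |τ|≡l : length τ ≡ l
  |τ|≡l = trans (proj₁ τ≅σ) (perm-length σ-perm)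
  small : length π′ ≤ (l ∸ 1) * (k + 1) + 1
  small = subst₂ (λ L K → length π′ ≤ (L ∸ 1) * (K + 1) + 1) |τ|≡l zeros π′-small
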